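{- Let $X$ be an orthomodular lattice. Then $\mathrm{Lin}(X)$, with pointwise order, composition, identity map, the involution $f\mapsto f^*$, and the map $[s]=\pi_{s^*(1)^\perp}$ (the Sasaki projection $y\mapsto s^*(1)^\perp\wedge(s^*(1)\vee y)$), is a Foulis m-semilattice.
   Context: Orthomodular lattice: a bounded lattice $X$ with a map $x\mapsto x^\perp$ such that $x^{\perp\perp}=x$, $x\le y\Rightarrow y^\perp\le x^\perp$, $x\wedge x^\perp=0$, and $x\le y$ implies $y=x\vee(x^\perp\wedge y)$. Write $x\perp y$ iff $x\le y^\perp$. A linear map $f\colon X\to X$ is a function for which there exists $h\colon X\to X$ (its adjoint, unique, denoted $f^*$) with $f(x)\perp y\iff x\perp h(y)$; $\mathrm{Lin}(X)$ is the set of such maps. An m-semilattice is a join-semilattice $(S,\sqcup,0)$ with an associative multiplication distributing over finite joins on both sides; unital if it has a two-sided unit $e$; involutive if it has ${}^*$ with $s^{**}=s$, $(st)^*=t^*s^*$, $(\bigsqcup_i x_i)^*=\bigsqcup_i x_i^*$ (finite families). A Foulis semigroup is a monoid $(S,\cdot,e)$ with maps ${}^*$ and $[-]$ such that: $e^*=e$, $(st)^*=t^*s^*$, $s^{**}=s$; $[s]\cdot[s]=[s]=[s]^*$; $0:=[e]$ satisfies $0\cdot s=0=s\cdot 0$; and $s\cdot t=0$ iff $t=[s]\cdot y$ for some $y\in S$. A Foulis m-semilattice is an involutive unital m-semilattice which, with its multiplication and involution, forms a Foulis semigroup (with some map $[-]$). -}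

module Defs where

open import Level using (Level; _⊔_; suc)
open import Data.Product using (Σ; ∃; _×_; _,_; proj₁; proj₂)
open import Function using (_∘_; id)
open import Relation.Binary.PropositionalEquality using (_≡_; subst)
open import Relation.Binary.Structures using (IsEquivalence)
open import Relation.Binary.Definitions using (Minimum)
open import Relation.Binary.Lattice.Structures using (IsBoundedLattice; IsJoinSemilattice)

record OrthomodularLattice (c ℓ : Level) : Set (suc (c ⊔ ℓ)) where
  infix 4 _≤_
  infixr 6 _∨_
  infixr 7 _∧_
  infix 8 _ᗮ
  field
    Carrier : Set c
    _≤_     : Carrier → Carrier → Set ℓ
    _∨_     : Carrier → Carrier → Carrier
    _∧_     : Carrier → Carrier → Carrier
    1#      : Carrier
    0#      : Carrier
    isBoundedLattice : IsBoundedLattice _≡_ _≤_ _∨_ _∧_ 1# 0#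
    _ᗮ      : Carrier → Carrier
    ᗮ-involutive : ∀ x → x ᗮ ᗮ ≡ x
    ᗮ-antitone   : ∀ {x y} → x ≤ y → y ᗮ ≤ x ᗮ
    ᗮ-meet       : ∀ x → x ∧ x ᗮ ≡ 0#
    orthomodular : ∀ {x y} → x ≤ y → y ≡ x ∨ (x ᗮ ∧ y)

  _⊥_ : Carrier → Carrier → Set ℓ
  x ⊥ y = x ≤ y ᗮ

  ⊥-sym : ∀ {x y} → x ⊥ y → y ⊥ x
  ⊥-sym {x} {y} p = subst (λ z → z ≤ x ᗮ) (ᗮ-involutive y) (ᗮ-antitone p)

module _ {c ℓ : Level} (X : OrthomodularLattice c ℓ) where
  open OrthomodularLattice X

  record Lin : Set (c ⊔ ℓ) where
    field
      fun : Carrier → Carrier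
      adj : Carrier → Carrier
      adjoint : ∀ x y → (fun x ⊥ y → x ⊥ adj y) × (x ⊥ adj y → fun x ⊥ y)
  open Lin public

  _≈L_ : Lin → Lin → Set c
  f ≈L g = ∀ x → fun f x ≡ fun g x

  _≤L_ : Lin → Lin → Set (c ⊔ ℓ)
  f ≤L g = ∀ x → fun f x ≤ fun g x

  _∘L_ : Lin → Lin → Lin
  f ∘L g = record
    { fun = fun f ∘ fun g
    ; adj = adj g ∘ adj f
    ; adjoint = λ x y →
        (λ p → proj₁ (adjoint g x (adj f y)) (proj₁ (adjoint f (fun g x) y) p))
      , (λ p → proj₂ (adjoint f (fun g x) y) (proj₂ (adjoint g x (adj f y)) p))
    }

  idL : Lin
  idL = record { fun = id ; adj = id ; adjoint = λ x y → (λ p → p) , (λ p → p) }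

  _*L : Lin → Lin
  f *L = record
    { fun = adj f
    ; adj = fun f
    ; adjoint = λ x y →
        (λ p → ⊥-sym (proj₂ (adjoint f y x) (⊥-sym p)))
      , (λ p → ⊥-sym (proj₁ (adjoint f y x) (⊥-sym p)))
    }

  sasakiBracket : Lin → Carrier → Carrier
  sasakiBracket s y = (adj s 1#) ᗮ ∧ (adj s 1# ∨ y)

record IsFoulisMSemilattice {a ℓ₁ ℓ₂ : Level} (S : Set a)
    (_≈_ : S → S → Set ℓ₁) (_≤_ : S → S → Set ℓ₂)
    (_⊔ₛ_ : S → S → S) (𝟎 : S)
    (_·_ : S → S → S) (e : S) (_* : S → S) ([_] : S → S)
    : Set (a ⊔ ℓ₁ ⊔ ℓ₂) where
  field
    isJoinSemilattice : IsJoinSemilattice _≈_ _≤_ _⊔ₛ_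
    minimum           : Minimum _≤_ 𝟎
    ·-cong   : ∀ {x y u v} → x ≈ y → u ≈ v → (x · u) ≈ (y · v)
    ·-assoc  : ∀ x y z → ((x · y) · z) ≈ (x · (y · z))
    distribˡ : ∀ s x y → (s · (x ⊔ₛ y)) ≈ ((s · x) ⊔ₛ (s · y))
    distribʳ : ∀ s x y → ((x ⊔ₛ y) · s) ≈ ((x · s) ⊔ₛ (y · s))
    zeroˡ    : ∀ s → (𝟎 · s) ≈ 𝟎
    zeroʳ    : ∀ s → (s · 𝟎) ≈ 𝟎
    identityˡ : ∀ s → (e · s) ≈ s
    identityʳ : ∀ s → (s · e) ≈ s
    *-cong      : ∀ {x y} → x ≈ y → (x *) ≈ (y *)
    *-involutive : ∀ s → ((s *) *) ≈ s
    *-antihom   : ∀ s t → ((s · t) *) ≈ ((t *) · (s *))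
    *-⊔         : ∀ x y → ((x ⊔ₛ y) *) ≈ ((x *) ⊔ₛ (y *))
    *-𝟎         : (𝟎 *) ≈ 𝟎
    e*          : (e *) ≈ e
    []-cong     : ∀ {x y} → x ≈ y → [ x ] ≈ [ y ]
    []-idem     : ∀ s → ([ s ] · [ s ]) ≈ [ s ]
    []-selfadj  : ∀ s → [ s ] ≈ ([ s ] *)
    []e-zeroˡ   : ∀ s → ([ e ] · s) ≈ [ e ]
    []e-zeroʳ   : ∀ s → (s · [ e ]) ≈ [ e ]
    foulis      : ∀ s t → ((s · t) ≈ [ e ] → ∃ λ y → t ≈ ([ s ] · y))
                        × ((∃ λ y → t ≈ ([ s ] · y)) → (s · t) ≈ [ e ])

{-# OPTIONS --safe #-}
-- A linear map f is residuated: f x ≤ z iff x ≤ (f*(zᗮ))ᗮ, so it preserves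
-- finite joins and 0, which gives the distributive and zero laws for composition
-- with pointwise joins.  The Foulis condition rests on two facts: s x = 0 iff
-- x ⊥ s*(1), and the Sasaki projection onto s*(1)ᗮ is self-adjoint, takes values
-- orthogonal to s*(1) and fixes every such element.  Hence s t = 0 iff [s] t = t.
module Submission where

open import Defs
open import Level using (Level; _⊔_)
open import Data.Product using (∃; _×_; _,_; proj₁; proj₂)
open import Relation.Binary.PropositionalEquality
  using (_≡_; refl; sym; trans; cong; subst; subst₂; module ≡-Reasoning)
open import Relation.Binary.Structures using (IsEquivalence)
open import Relation.Binary.Lattice.Bundles using (BoundedLattice)
open import Relation.Binary.Lattice.Structures using (IsJoinSemilattice)
import Relation.Binary.Reasoning.PartialOrder

module OrthomodularLatticeProperties {c ℓ : Level} (X : OrthomodularLattice c ℓ) where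
  open OrthomodularLattice X

  boundedLattice : BoundedLattice c c ℓ
  boundedLattice = record { isBoundedLattice = isBoundedLattice }

  open BoundedLattice boundedLattice public
    using (poset; antisym; x≤x∨y; y≤x∨y; ∨-least; x∧y≤x; x∧y≤y; ∧-greatest; maximum; minimum)
    renaming (refl to ≤-refl; reflexive to ≤-reflexive; trans to ≤-trans)
  open import Relation.Binary.Lattice.Properties.BoundedJoinSemilattice
    (BoundedLattice.boundedJoinSemilattice boundedLattice)
    using () renaming (identityʳ to ∨-identityʳ)

  ≤⇒⊥ᗮ : ∀ {x y} → x ≤ y → x ⊥ (y ᗮ)
  ≤⇒⊥ᗮ {x} {y} = subst (x ≤_) (sym (ᗮ-involutive y))

  ⊥ᗮ⇒≤ : ∀ {x y} → x ⊥ (y ᗮ) → x ≤ y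
  ⊥ᗮ⇒≤ {x} {y} = subst (x ≤_) (ᗮ-involutive y)

  ᗮ-reflects-≤ : ∀ {x y} → x ᗮ ≤ y ᗮ → y ≤ x
  ᗮ-reflects-≤ {x} {y} p = subst₂ _≤_ (ᗮ-involutive y) (ᗮ-involutive x) (ᗮ-antitone p)

  ⊥a⇒⊥b⇒b≤a : ∀ {a b} → (∀ {x} → x ⊥ a → x ⊥ b) → b ≤ a
  ⊥a⇒⊥b⇒b≤a h = ᗮ-reflects-≤ (h ≤-refl)

  ⊥-∨ʳ : ∀ {x y z} → x ⊥ y → x ⊥ z → x ⊥ (y ∨ z)
  ⊥-∨ʳ p q = ⊥-sym (∨-least (⊥-sym p) (⊥-sym q))

  ⊥-antitoneʳ : ∀ {x y z} → x ⊥ y → z ≤ y → x ⊥ z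
  ⊥-antitoneʳ p q = ≤-trans p (ᗮ-antitone q)

  ≤∧⊥⇒≡0 : ∀ {x y} → x ≤ y → x ⊥ y → x ≡ 0#
  ≤∧⊥⇒≡0 {x} {y} p q = antisym (subst (x ≤_) (ᗮ-meet y) (∧-greatest p q)) (minimum x)

  sasaki : Carrier → Carrier → Carrier
  sasaki p y = p ᗮ ∧ (p ∨ y)

  sasaki-⊥ : ∀ p y → sasaki p y ⊥ p
  sasaki-⊥ p y = x∧y≤x (p ᗮ) (p ∨ y)

  sasaki-1 : ∀ y → sasaki 1# y ≡ 0#
  sasaki-1 y = ≤∧⊥⇒≡0 (maximum _) (sasaki-⊥ 1# y)

  -- The orthomodular remainder zᗮ ∧ sasaki p z lies below p ∨ z and is
  -- orthogonal to both p and z, hence vanishes.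
  sasaki-fixes-⊥ : ∀ {p z} → z ⊥ p → sasaki p z ≡ z
  sasaki-fixes-⊥ {p} {z} z⊥p = begin
    sasaki p z             ≡⟨ orthomodular z≤sasaki ⟩
    z ∨ (z ᗮ ∧ sasaki p z) ≡⟨ cong (z ∨_) remainder≡0 ⟩
    z ∨ 0#                 ≡⟨ ∨-identityʳ z ⟩
    z                      ∎
    where
    open ≡-Reasoning
    z≤sasaki : z ≤ sasaki p z
    z≤sasaki = ∧-greatest z⊥p (y≤x∨y p z)
    remainder≡0 : z ᗮ ∧ sasaki p z ≡ 0#
    remainder≡0 = ≤∧⊥⇒≡0
      (≤-trans (x∧y≤y _ _) (x∧y≤y _ _))
      (⊥-∨ʳ (≤-trans (x∧y≤y _ _) (sasaki-⊥ p z)) (x∧y≤x _ _))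

  sasaki-selfAdjoint : ∀ p {x y} → sasaki p x ⊥ y → x ⊥ sasaki p y
  sasaki-selfAdjoint p {x} {y} h = begin
    x                ≤⟨ y≤x∨y p x ⟩
    p ∨ x            ≡⟨ orthomodular (x≤x∨y p x) ⟩
    p ∨ sasaki p x   ≤⟨ ∨-least (⊥-sym (sasaki-⊥ p y)) sasaki⊥sasaki ⟩
    sasaki p y ᗮ     ∎
    where
    open Relation.Binary.Reasoning.PartialOrder poset
    sasaki⊥sasaki : sasaki p x ⊥ sasaki p y
    sasaki⊥sasaki = ⊥-antitoneʳ (⊥-∨ʳ (sasaki-⊥ p x) h) (x∧y≤y (p ᗮ) (p ∨ y))

module LinearMapProperties {c ℓ : Level} (X : OrthomodularLattice c ℓ) where
  open OrthomodularLattice X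
  open OrthomodularLatticeProperties X

  residual : Lin X → Carrier → Carrier
  residual f z = adj f (z ᗮ) ᗮ

  fun≤⇒≤residual : ∀ (f : Lin X) {x z} → fun f x ≤ z → x ≤ residual f z
  fun≤⇒≤residual f {x} {z} p = proj₁ (adjoint f x (z ᗮ)) (≤⇒⊥ᗮ p)

  ≤residual⇒fun≤ : ∀ (f : Lin X) {x z} → x ≤ residual f z → fun f x ≤ z
  ≤residual⇒fun≤ f {x} {z} p = ⊥ᗮ⇒≤ (proj₂ (adjoint f x (z ᗮ)) p)

  fun-monotone : ∀ (f : Lin X) {x y} → x ≤ y → fun f x ≤ fun f y
  fun-monotone f x≤y = ≤residual⇒fun≤ f (≤-trans x≤y (fun≤⇒≤residual f ≤-refl))

  fun-∨ : ∀ (f : Lin X) x y → fun f (x ∨ y) ≡ fun f x ∨ fun f y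
  fun-∨ f x y = antisym
    (≤residual⇒fun≤ f (∨-least (fun≤⇒≤residual f (x≤x∨y _ _))
                               (fun≤⇒≤residual f (y≤x∨y _ _))))
    (∨-least (fun-monotone f (x≤x∨y x y)) (fun-monotone f (y≤x∨y x y)))

  fun≡0⇒⊥adj1 : ∀ (f : Lin X) {x} → fun f x ≡ 0# → x ⊥ adj f 1#
  fun≡0⇒⊥adj1 f {x} fx≡0 = proj₁ (adjoint f x 1#) (subst (_⊥ 1#) (sym fx≡0) (minimum _))

  ⊥adj1⇒fun≡0 : ∀ (f : Lin X) {x} → x ⊥ adj f 1# → fun f x ≡ 0#
  ⊥adj1⇒fun≡0 f {x} p = ≤∧⊥⇒≡0 (maximum _) (proj₂ (adjoint f x 1#) p)

  fun-0 : ∀ (f : Lin X) → fun f 0# ≡ 0#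
  fun-0 f = ⊥adj1⇒fun≡0 f (minimum _)

  adj-cong : ∀ {f g} → _≈L_ X f g → ∀ y → adj f y ≡ adj g y
  adj-cong {f} {g} f≈g y = antisym
    (⊥a⇒⊥b⇒b≤a (transfer g f (λ x → sym (f≈g x))))
    (⊥a⇒⊥b⇒b≤a (transfer f g f≈g))
    where
    transfer : ∀ (f g : Lin X) → _≈L_ X f g → ∀ {x} → x ⊥ adj f y → x ⊥ adj g y
    transfer f g f≈g {x} p =
      proj₁ (adjoint g x y) (subst (_⊥ y) (f≈g x) (proj₂ (adjoint f x y) p))

module FoulisMSemilatticeOfLinearMaps {c ℓ : Level} (X : OrthomodularLattice c ℓ) where
  open OrthomodularLattice X
  open OrthomodularLatticeProperties X
  open LinearMapProperties X

  infix 4 _≈_ _≤ₗ_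
  infixr 9 _·_
  infixr 6 _⊔L_

  _≈_ : Lin X → Lin X → Set c
  _≈_ = _≈L_ X

  _≤ₗ_ : Lin X → Lin X → Set (c ⊔ ℓ)
  _≤ₗ_ = _≤L_ X

  _·_ : Lin X → Lin X → Lin X
  _·_ = _∘L_ X

  _⊔L_ : Lin X → Lin X → Lin X
  f ⊔L g = record
    { fun = λ x → fun f x ∨ fun g x
    ; adj = λ y → adj f y ∨ adj g y
    ; adjoint = λ x y →
        (λ p → ⊥-∨ʳ (proj₁ (adjoint f x y) (≤-trans (x≤x∨y _ _) p))
                    (proj₁ (adjoint g x y) (≤-trans (y≤x∨y _ _) p)))
      , (λ p → ∨-least (proj₂ (adjoint f x y) (⊥-antitoneʳ p (x≤x∨y _ _)))
                       (proj₂ (adjoint g x y) (⊥-antitoneʳ p (y≤x∨y _ _))))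
    }

  𝟎L : Lin X
  𝟎L = record
    { fun = λ _ → 0#
    ; adj = λ _ → 0#
    ; adjoint = λ x y → (λ _ → ⊥-sym (minimum _)) , (λ _ → minimum _)
    }

  sasakiL : Carrier → Lin X
  sasakiL p = record
    { fun = sasaki p
    ; adj = sasaki p
    ; adjoint = λ x y → sasaki-selfAdjoint p , (λ q → ⊥-sym (sasaki-selfAdjoint p (⊥-sym q)))
    }

  [_] : Lin X → Lin X
  [ s ] = sasakiL (adj s 1#)

  ≈-isEquivalence : IsEquivalence _≈_
  ≈-isEquivalence = record
    { refl  = λ _ → refl
    ; sym   = λ f≈g x → sym (f≈g x)
    ; trans = λ f≈g g≈h x → trans (f≈g x) (g≈h x)
    }

  ≤ₗ-isJoinSemilattice : IsJoinSemilattice _≈_ _≤ₗ_ _⊔L_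
  ≤ₗ-isJoinSemilattice = record
    { isPartialOrder = record
      { isPreorder = record
        { isEquivalence = ≈-isEquivalence
        ; reflexive     = λ f≈g x → ≤-reflexive (f≈g x)
        ; trans         = λ f≤g g≤h x → ≤-trans (f≤g x) (g≤h x)
        }
      ; antisym = λ f≤g g≤f x → antisym (f≤g x) (g≤f x)
      }
    ; supremum = λ f g → (λ _ → x≤x∨y _ _) , (λ _ → y≤x∨y _ _)
                       , λ h f≤h g≤h x → ∨-least (f≤h x) (g≤h x)
    }

  [idL]≈𝟎 : [ idL X ] ≈ 𝟎L
  [idL]≈𝟎 = sasaki-1

  s·[s]≈𝟎 : ∀ s → s · [ s ] ≈ 𝟎L
  s·[s]≈𝟎 s z = ⊥adj1⇒fun≡0 s (sasaki-⊥ (adj s 1#) z)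

  s·t≈𝟎⇒[s]·t≈t : ∀ {s t} → s · t ≈ 𝟎L → [ s ] · t ≈ t
  s·t≈𝟎⇒[s]·t≈t {s} st≈𝟎 z = sasaki-fixes-⊥ (fun≡0⇒⊥adj1 s (st≈𝟎 z))

  isFoulisMSemilattice :
    IsFoulisMSemilattice (Lin X) _≈_ _≤ₗ_ _⊔L_ 𝟎L _·_ (idL X) (_*L X) [_]
  isFoulisMSemilattice = record
    { isJoinSemilattice = ≤ₗ-isJoinSemilattice
    ; minimum      = λ _ _ → minimum _
    ; ·-cong       = λ {f} f≈g u≈v x → trans (cong (fun f) (u≈v x)) (f≈g _)
    ; ·-assoc      = λ _ _ _ _ → refl
    ; distribˡ     = λ s _ _ _ → fun-∨ s _ _
    ; distribʳ     = λ _ _ _ _ → refl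
    ; zeroˡ        = λ _ _ → refl
    ; zeroʳ        = λ s _ → fun-0 s
    ; identityˡ    = λ _ _ → refl
    ; identityʳ    = λ _ _ → refl
    ; *-cong       = λ {f} {g} → adj-cong {f} {g}
    ; *-involutive = λ _ _ → refl
    ; *-antihom    = λ _ _ _ → refl
    ; *-⊔          = λ _ _ _ → refl
    ; *-𝟎          = λ _ → refl
    ; e*           = λ _ → refl
    ; []-cong      = λ {f} {g} f≈g z → cong (λ p → sasaki p z) (adj-cong {f} {g} f≈g 1#)
    ; []-idem      = λ s → s·t≈𝟎⇒[s]·t≈t {s} {[ s ]} (s·[s]≈𝟎 s)
    ; []-selfadj   = λ _ _ → refl
    ; []e-zeroˡ    = λ _ z → trans ([idL]≈𝟎 _) (sym ([idL]≈𝟎 z))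
    ; []e-zeroʳ    = λ s z → trans (cong (fun s) ([idL]≈𝟎 z)) (trans (fun-0 s) (sym ([idL]≈𝟎 z)))
    ; foulis       = λ s t → annihilated⇒range s t , range⇒annihilated s t
    }
    where
    annihilated⇒range : ∀ s t → s · t ≈ [ idL X ] → ∃ λ y → t ≈ [ s ] · y
    annihilated⇒range s t st≈[e] =
      t , λ z → sym (s·t≈𝟎⇒[s]·t≈t {s} {t} (λ x → trans (st≈[e] x) ([idL]≈𝟎 x)) z)
    range⇒annihilated : ∀ s t → (∃ λ y → t ≈ [ s ] · y) → s · t ≈ [ idL X ]
    range⇒annihilated s t (y , t≈[s]y) z =
      trans (cong (fun s) (t≈[s]y z)) (trans (s·[s]≈𝟎 s (fun y z)) (sym ([idL]≈𝟎 z)))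

mainTheorem9 : ∀ {c ℓ : Level} (X : OrthomodularLattice c ℓ) →
    ∃ λ (_⊔L_ : Lin X → Lin X → Lin X) → ∃ λ (𝟎L : Lin X) → ∃ λ (br : Lin X → Lin X) →
      (∀ s y → Lin.fun {X = X} (br s) y ≡ sasakiBracket X s y)
      × IsFoulisMSemilattice (Lin X) (_≈L_ X) (_≤L_ X) _⊔L_ 𝟎L (_∘L_ X) (idL X) (_*L X) br
mainTheorem9 X = _⊔L_ , 𝟎L , [_] , (λ _ _ → refl) , isFoulisMSemilattice
  where open FoulisMSemilatticeOfLinearMaps X
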